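{- Let $c,h,d\in\omega^\omega$ with $c>h$, $h(i)\ge1$ for all but finitely many $i$, $d\ge2$, $\limsup_{n}\frac{1}{d(n)}\log_{d(n)}h(n)=\infty$, and $d$ going to infinity. Let $\langle A_n\mid n<\omega\rangle$ be a sequence of non-empty finite sets with $|\prod_{i<n}A_i|\le d(n)$ for all $n<\omega$, and let $\dot\tau$ be a $\mathbb{Q}^d_{c,h}$-name for a member of $\prod_{n<\omega}A_n$. Then for any $p\in\mathbb{Q}^d_{c,h}$ there is $q\le p$ which reads $\dot\tau$ early: for any $n<\omega$ and $\eta\in\mathrm{poss}(q,<n)$, the condition $q\wedge\eta$ decides $\dot\tau\restriction n$.
   Context: Natural numbers are identified with $\{0,\dots,n-1\}$. For non-empty $M\subseteq[c(n)]^{\le h(n)}$, $\|M\|_{c,h,n}:=\max\{k\mid\forall Y\in[c(n)]^{\le k}\ \exists X\in M: Y\subseteq X\}$ and $\|M\|^d_{c,h,n}:=\frac{1}{d(n)}\log_{d(n)}(\|M\|_{c,h,n}+1)$. The poset $\mathbb{Q}^d_{c,h}$: conditions are sequences $p=\langle p(n)\mid n<\omega\rangle$ with each $p(n)$ a non-empty subset of $[c(n)]^{\le h(n)}$ and $\limsup_n\|p(n)\|^d_{c,h,n}=\infty$; $q\le p$ iff $q(n)\subseteq p(n)$ for all $n$. $\mathrm{poss}(p,\le k):=\{\langle\{z(\ell)\}\mid\ell\le k\rangle\mid\forall\ell\le k: z(\ell)\in p(\ell)\}$, $\mathrm{poss}(p,<k):=\mathrm{poss}(p,\le k-1)$ (only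 the empty sequence for $k=0$); for $\eta\in\mathrm{poss}(p,\le k)$, $p\wedge\eta$ is the condition equal to $\eta(\ell)$ at $\ell\le k$ and to $p(\ell)$ at $\ell>k$. -}

module Defs where

open import Data.Nat using (ℕ; zero; suc; _*_; _^_; _≤_; _<_)
open import Data.Nat.Properties using (_<?_)
open import Data.Fin using (Fin)
open import Data.Fin.Subset using (Subset; ∣_∣; _⊆_)
open import Data.Bool using (Bool; true; false)
import Data.Bool.Properties as BoolP
open import Data.Vec.Properties using (≡-dec)
open import Data.Product using (Σ; _×_; proj₁)
open import Relation.Nullary using (¬_; yes; no)
open import Relation.Nullary.Decidable using (⌊_⌋)
open import Relation.Binary.PropositionalEquality using (_≡_)

-- A "raw" sequence: for each n a subset of P([c(n)]), given by a Bool-valued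
-- membership predicate on subsets of c(n) = {0,…,c(n)-1} (Subset = Vec Bool).
Seq : (ℕ → ℕ) → Set
Seq c = (n : ℕ) → Subset (c n) → Bool

Covers : ∀ {m} → (Subset m → Bool) → ℕ → Set
Covers {m} M k = (Y : Subset m) → ∣ Y ∣ ≤ k → Σ (Subset m) (λ X → (M X ≡ true) × (Y ⊆ X))

-- ‖M‖ = k  (k is the maximum of the k with Covers M k; Covers is downward closed)
NormIs : ∀ {m} → (Subset m → Bool) → ℕ → Set
NormIs M k = Covers M k × ¬ Covers M (suc k)

-- ‖M‖^d > r  for a natural r, where D = d(n):
-- (1/D) log_D (‖M‖+1) > r   iff   ‖M‖ + 1 > D^(D·r)
NormdAbove : ∀ {m} → (D : ℕ) → (Subset m → Bool) → ℕ → Set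
NormdAbove D M r = Σ ℕ (λ k → NormIs M k × (D ^ (D * r) < suc k))

IsCond : (c h d : ℕ → ℕ) → Seq c → Set
IsCond c h d p =
  ((n : ℕ) → Σ (Subset (c n)) (λ X → p n X ≡ true)) ×
  ((n : ℕ) (X : Subset (c n)) → p n X ≡ true → ∣ X ∣ ≤ h n) ×
  ((r N : ℕ) → Σ ℕ (λ n → (N ≤ n) × NormdAbove (d n) (p n) r))

_≤Q_ : ∀ {c} → Seq c → Seq c → Set
_≤Q_ {c} q p = (n : ℕ) (X : Subset (c n)) → q n X ≡ true → p n X ≡ true

Poss : ∀ {c} → Seq c → ℕ → Set
Poss {c} p n = (ℓ : ℕ) → ℓ < n → Σ (Subset (c ℓ)) (λ X → p ℓ X ≡ true)

wedge : ∀ {c} (p : Seq c) (n : ℕ) → Poss p n → Seq c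
wedge p n η ℓ with ℓ <? n
... | yes l<n = λ X → ⌊ ≡-dec BoolP._≟_ X (proj₁ (η ℓ l<n)) ⌋
... | no _    = p ℓ

-- |∏_{i<n} A_i| where |A_i| = a i
prodUpTo : (ℕ → ℕ) → ℕ → ℕ
prodUpTo a zero    = 1
prodUpTo a (suc n) = prodUpTo a n * a n

-- A Q^d_{c,h}-name τ for a member of ∏_n A_n (A_n = Fin (a n)), given by its
-- forcing relation  Forces p n x  ≡  "p ⊩ τ(n) = x", with the properties that
-- characterise the forcing relation of such a name.
record Name (c h d a : ℕ → ℕ) : Set₁ where
  field
    Forces     : Seq c → (n : ℕ) → Fin (a n) → Set
    mono       : (p q : Seq c) (n : ℕ) (x : Fin (a n)) → IsCond c h d p → IsCond c h d q →
                 q ≤Q p → Forces p n x → Forces q n x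
    dense      : (p : Seq c) (n : ℕ) → IsCond c h d p →
                 Σ (Seq c) (λ q → IsCond c h d q × (q ≤Q p) × Σ (Fin (a n)) (λ x → Forces q n x))
    consistent : (p : Seq c) (n : ℕ) (x y : Fin (a n)) → IsCond c h d p →
                 Forces p n x → Forces p n y → x ≡ y
    closed     : (p : Seq c) (n : ℕ) (x : Fin (a n)) → IsCond c h d p →
                 ((q : Seq c) → IsCond c h d q → q ≤Q p →
                   Σ (Seq c) (λ r → IsCond c h d r × (r ≤Q q) × Forces r n x)) →
                 Forces p n x

Decides : ∀ {c h d a} → Name c h d a → Seq c → ℕ → Set
Decides {a = a} τ q n =
  Σ ((i : ℕ) → i < n → Fin (a i)) (λ f → (i : ℕ) (lt : i < n) → Name.Forces τ q i (f i lt))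

-- The proof is a fusion.  A stage is a condition r with a front m such that r ∧ η
-- decides τ↾n for all n ≤ m and η ∈ poss(r,<n).  To pass from stage j to stage j+1,
-- with E the number of possibilities below m:
--   1. pick k ≥ m with ‖r(k)‖^d > j + E and collapse the levels in [m,k) to
--      singletons, so that poss(·,<k) again has only E elements;
--   2. strengthen above the finitely many η ∈ poss(·,≤k) so that every such
--      ∧ η decides τ↾(k+1), leaving the levels ≤ k unchanged;
--   3. colour x ∈ r(k) by the value of τ↾k decided above (η below m) ⌢ x: at most
--      |∏_{i<k} A_i| ≤ d(k) colours, E colourings.  Iterated pigeonhole thins r(k)
--      to a homogeneous family at the cost of a factor d(k)^E in the norm, so
--      ‖·‖^d > j survives; homogeneity and closure of forcing give τ↾k, hence τ↾n
--      for n ∈ (m, k], and step 2 gives τ↾(k+1).  The new front is k+1.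
-- The fusion q(ℓ) = r_{ℓ+1}(ℓ) inherits the norms and the reading of all stages.
module Submission where

open import Defs
open import Data.Nat using (ℕ; zero; suc; _+_; _*_; _^_; _∸_; _≤_; _<_; _⊔_; _≤′_; ≤′-refl; ≤′-step; z≤n; s≤s)
open import Data.Nat.Properties
open import Data.Fin using (Fin; combine; fromℕ<) renaming (_≟_ to _≟ᶠ_)
open import Data.Fin.Properties using (combine-injective)
open import Data.Fin.Subset using (Subset; ∣_∣; _⊆_; _∪_; ⊥; ⊤; inside; outside)
open import Data.Fin.Subset.Properties using (anySubset?; _⊆?_; p⊆p∪q; q⊆p∪q; ∣⊥∣≡0; ∣⊤∣≡n; p⊆q⇒∣p∣≤∣q∣)
open import Data.Bool using (Bool; true; false; _∧_; not)
import Data.Bool.Properties as BoolP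
open import Data.Vec using ([]; _∷_)
open import Data.Vec.Properties using (≡-dec)
open import Data.List using (List; []; _∷_; length; allFin; map; _++_; filter; cartesianProductWith)
open import Data.List.Properties using (length-tabulate)
open import Data.List.Membership.Propositional using (_∈_)
open import Data.List.Membership.Propositional.Properties
  using (∈-allFin; ∈-++⁺ˡ; ∈-++⁺ʳ; ∈-map⁺; ∈-filter⁺; ∈-filter⁻; ∈-cartesianProductWith⁺; ∈-cartesianProductWith⁻)
open import Data.List.Relation.Unary.Any using (here; there)
open import Data.Product using (Σ; _×_; _,_; proj₁; proj₂)
open import Data.Sum using (_⊎_; inj₁; inj₂)
open import Data.Empty using (⊥-elim)
open import Relation.Nullary using (¬_; yes; no; Dec; ¬?; does)
open import Relation.Nullary.Decidable using (⌊_⌋; _×-dec_; dec-true; dec-false; isYes≗does)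
open import Relation.Binary using (DecidableEquality)
open import Relation.Binary.PropositionalEquality using (_≡_; _≢_; refl; sym; trans; cong; cong₂; subst; module ≡-Reasoning)

does-true : ∀ {A : Set} (a? : Dec A) → does a? ≡ true → A
does-true (yes a) _ = a

isYes-true : ∀ {A : Set} (a? : Dec A) → ⌊ a? ⌋ ≡ true → A
isYes-true (yes a) _ = a

isYes-intro : ∀ {A : Set} (a? : Dec A) → A → ⌊ a? ⌋ ≡ true
isYes-intro a? a = trans (isYes≗does a?) (dec-true a? a)

ifTrue : {F : Set} (b : Bool) → (b ≡ true → F) → F → F
ifTrue true  f _ = f refl
ifTrue false _ z = z

ifTrue-true : {F : Set} (b : Bool) (f : b ≡ true → F) (z : F) (e : b ≡ true) → ifTrue b f z ≡ f e
ifTrue-true true f z refl = refl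

Family : ℕ → Set
Family m = Subset m → Bool

CoveredBy : ∀ {m} → Family m → Subset m → Set
CoveredBy {m} M Y = Σ (Subset m) (λ X → (M X ≡ true) × (Y ⊆ X))

covers-or-misses : ∀ {m} (M : Family m) (k : ℕ) →
                   Covers M k ⊎ Σ (Subset m) (λ Y → (∣ Y ∣ ≤ k) × ¬ CoveredBy M Y)
covers-or-misses M k
  with anySubset? (λ Y → (∣ Y ∣ ≤? k) ×-dec ¬? (anySubset? (λ X → (M X BoolP.≟ true) ×-dec (Y ⊆? X))))
... | yes missed = inj₂ missed
... | no none    = inj₁ covered
  where
  covered : Covers M k
  covered Y small with anySubset? (λ X → (M X BoolP.≟ true) ×-dec (Y ⊆? X))
  ... | yes cov = cov
  ... | no unc  = ⊥-elim (none (Y , small , unc))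

Covers-mono : ∀ {m} {M M' : Family m} {k k'} → (∀ X → M X ≡ true → M' X ≡ true) →
              k' ≤ k → Covers M k → Covers M' k'
Covers-mono M⊆M' k'≤k cov Y small with cov Y (≤-trans small k'≤k)
... | X , X∈M , Y⊆X = X , M⊆M' X X∈M , Y⊆X

Covers-nonempty : ∀ {m} {M : Family m} {k} → Covers M k → Σ (Subset m) (λ X → M X ≡ true)
Covers-nonempty {m} cov with cov ⊥ (≤-trans (≤-reflexive (∣⊥∣≡0 m)) z≤n)
... | X , X∈M , _ = X , X∈M

∣∪∣≤ : ∀ {n} (p q : Subset n) → ∣ p ∪ q ∣ ≤ ∣ p ∣ + ∣ q ∣
∣∪∣≤ [] [] = z≤n
∣∪∣≤ (outside ∷ p) (outside ∷ q) = ∣∪∣≤ p q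
∣∪∣≤ (outside ∷ p) (inside ∷ q)  = ≤-trans (s≤s (∣∪∣≤ p q)) (≤-reflexive (sym (+-suc ∣ p ∣ ∣ q ∣)))
∣∪∣≤ (inside ∷ p)  (outside ∷ q) = s≤s (∣∪∣≤ p q)
∣∪∣≤ (inside ∷ p)  (inside ∷ q)  = s≤s (≤-trans (∣∪∣≤ p q) (≤-trans (n≤1+n _) (≤-reflexive (sym (+-suc ∣ p ∣ ∣ q ∣)))))

pigeonhole : ∀ {m} {A : Set} (_≟A_ : DecidableEquality A) (vs : List A) (M : Family m)
             (col : Subset m → A) (K : ℕ) → (∀ X → M X ≡ true → col X ∈ vs) →
             Covers M (length vs * K) → Σ A (λ v → Covers (λ X → M X ∧ does (col X ≟A v)) K)
pigeonhole _≟A_ [] M col K coloured cov with coloured _ (proj₂ (Covers-nonempty cov))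
... | ()
pigeonhole {m} _≟A_ (v ∷ vs) M col K coloured cov with covers-or-misses (λ X → M X ∧ does (col X ≟A v)) K
... | inj₁ classCovers = v , classCovers
... | inj₂ (Y₀ , Y₀-small , Y₀-missed)
  with pigeonhole _≟A_ vs rest col K rest-coloured rest-covers
  where
  rest : Family m
  rest X = M X ∧ not (does (col X ≟A v))

  rest-coloured : ∀ X → rest X ≡ true → col X ∈ vs
  rest-coloured X X∈ with coloured X (BoolP.∧-conicalˡ (M X) _ X∈)
  ... | here col≡v = ⊥-elim (BoolP.not-¬ (sym (dec-true (col X ≟A v) col≡v)) (sym (BoolP.∧-conicalʳ (M X) _ X∈)))
  ... | there col∈ = col∈

  -- Y ∪ Y₀ is covered by M, and its cover cannot have colour v since Y₀ is missed.
  rest-covers : Covers rest (length vs * K)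
  rest-covers Y small
    with cov (Y ∪ Y₀) (≤-trans (∣∪∣≤ Y Y₀) (≤-trans (≤-reflexive (+-comm ∣ Y ∣ ∣ Y₀ ∣)) (+-mono-≤ Y₀-small small)))
  ... | X , X∈M , Y∪Y₀⊆X with col X ≟A v
  ... | yes col≡v = ⊥-elim (Y₀-missed (X , cong₂ _∧_ X∈M (dec-true (col X ≟A v) col≡v) , λ y∈ → Y∪Y₀⊆X (q⊆p∪q Y Y₀ y∈)))
  ... | no col≢v  = X , cong₂ _∧_ X∈M (cong not (dec-false (col X ≟A v) col≢v)) , λ y∈ → Y∪Y₀⊆X (p⊆p∪q Y₀ y∈)
... | v' , classCovers = v' , Covers-mono shrink ≤-refl classCovers
  where
  shrink : ∀ X → (M X ∧ not (does (col X ≟A v))) ∧ does (col X ≟A v') ≡ true → M X ∧ does (col X ≟A v') ≡ true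
  shrink X e = cong₂ _∧_ (BoolP.∧-conicalˡ (M X) _ (BoolP.∧-conicalˡ _ _ e)) (BoolP.∧-conicalʳ _ _ e)

homogenise : ∀ {m} {T : Set} (C : ℕ) (xs : List T) (col : ∀ t → t ∈ xs → Subset m → Fin C)
             (M : Family m) (K : ℕ) → Covers M (C ^ length xs * K) →
             Σ (Family m) (λ M' → (∀ X → M' X ≡ true → M X ≡ true) × Covers M' K ×
               (∀ t (t∈ : t ∈ xs) → Σ (Fin C) (λ w → ∀ X → M' X ≡ true → col t t∈ X ≡ w)))
homogenise C [] col M K cov =
  M , (λ X X∈ → X∈) , Covers-mono (λ X X∈ → X∈) (≤-reflexive (sym (*-identityˡ K))) cov , λ t ()
homogenise C (t ∷ xs) col M K cov
  with pigeonhole _≟ᶠ_ (allFin C) M (col t (here refl)) (C ^ length xs * K)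
                  (λ X _ → ∈-allFin (col t (here refl) X)) (subst (Covers M) regroup cov)
  where
  regroup : C ^ length (t ∷ xs) * K ≡ length (allFin C) * (C ^ length xs * K)
  regroup = trans (*-assoc C _ K) (cong (_* (C ^ length xs * K)) (sym (length-tabulate {n = C} (λ i → i))))
... | w , classCovers with homogenise C xs (λ t' t'∈ → col t' (there t'∈)) _ K classCovers
... | M' , M'⊆class , M'covers , constant = M' , M'⊆M , M'covers , constant'
  where
  M'⊆M : ∀ X → M' X ≡ true → M X ≡ true
  M'⊆M X X∈ = BoolP.∧-conicalˡ (M X) _ (M'⊆class X X∈)

  constant' : ∀ t' (t'∈ : t' ∈ t ∷ xs) → Σ (Fin C) (λ w' → ∀ X → M' X ≡ true → col t' t'∈ X ≡ w')
  constant' .t (here refl) = w , λ X X∈ → does-true (col t (here refl) X ≟ᶠ w) (BoolP.∧-conicalʳ (M X) _ (M'⊆class X X∈))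
  constant' t' (there t'∈) = constant t' t'∈

-- The norm ‖M‖ is the largest k with Covers M k.  It exists as soon as M does
-- not contain the full set [m]; searching upward from a known lower bound K:
norm-above : ∀ {m} (M : Family m) (t K : ℕ) → Covers M K → ¬ Covers M (t + K) →
             Σ ℕ (λ k → (K ≤ k) × NormIs M k)
norm-above M zero    K cov notCov = ⊥-elim (notCov cov)
norm-above M (suc t) K cov notCov with covers-or-misses M (suc K)
... | inj₂ (Y , small , missed) = K , ≤-refl , cov , λ cov' → missed (cov' Y small)
... | inj₁ cov' with norm-above M t (suc K) cov' (λ c → notCov (subst (Covers M) (+-suc t K) c))
... | k , K<k , norm = k , ≤-trans (n≤1+n K) K<k , norm

proper⇒¬Covers : ∀ {m} (M : Family m) → (∀ X → M X ≡ true → ∣ X ∣ < m) → ¬ Covers M m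
proper⇒¬Covers {m} M proper cov with cov ⊤ (≤-reflexive (∣⊤∣≡n m))
... | X , X∈M , ⊤⊆X = <⇒≱ (proper X X∈M) (≤-trans (≤-reflexive (sym (∣⊤∣≡n m))) (p⊆q⇒∣p∣≤∣q∣ ⊤⊆X))

NormdAbove-fromCovers : ∀ {m} (D : ℕ) (M : Family m) (r : ℕ) → (∀ X → M X ≡ true → ∣ X ∣ < m) →
                        Covers M (D ^ (D * r)) → NormdAbove D M r
NormdAbove-fromCovers {m} D M r proper cov with D ^ (D * r) ≤? m
... | no  K≰m = ⊥-elim (proper⇒¬Covers M proper (Covers-mono (λ X X∈ → X∈) (≰⇒≥ K≰m) cov))
... | yes K≤m with norm-above M (m ∸ D ^ (D * r)) _ cov
                   (subst (λ z → ¬ Covers M z) (sym (m∸n+n≡m K≤m)) (proper⇒¬Covers M proper))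
... | k , K≤k , norm = k , norm , s≤s K≤k

NormdAbove-toCovers : ∀ {m} (D : ℕ) (M : Family m) (r : ℕ) → NormdAbove D M r → Covers M (D ^ (D * r))
NormdAbove-toCovers D M r (k , (cov , _) , K<k+1) = Covers-mono (λ X X∈ → X∈) (≤-pred K<k+1) cov

NormdAbove-ext : ∀ {m} {D} {M M' : Family m} {r} → (∀ X → M X ≡ M' X) → NormdAbove D M r → NormdAbove D M' r
NormdAbove-ext M≗M' (k , (cov , notCov) , K<k+1) =
  k , (Covers-mono (λ X e → trans (sym (M≗M' X)) e) ≤-refl cov ,
       λ c → notCov (Covers-mono (λ X e → trans (M≗M' X) e) ≤-refl c)) , K<k+1

NormdAbove-mono : ∀ {m} {D} {M : Family m} {r r'} → 1 ≤ D → r' ≤ r → NormdAbove D M r → NormdAbove D M r'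
NormdAbove-mono {D = suc D} _ r'≤r (k , norm , K<k+1) =
  k , norm , ≤-<-trans (^-monoʳ-≤ (suc D) (*-monoʳ-≤ (suc D) r'≤r)) K<k+1

-- The arithmetic behind the homogenisation step: C^E · D^(D·j) ≤ D^(D·(j+E)) when C ≤ D.
colours-cost : ∀ C D j E → C ≤ D → 1 ≤ D → C ^ E * D ^ (D * j) ≤ D ^ (D * (j + E))
colours-cost C (suc D) j E C≤D _ = begin
  C ^ E * suc D ^ (suc D * j)                  ≤⟨ *-monoˡ-≤ _ (^-monoˡ-≤ E C≤D) ⟩
  suc D ^ E * suc D ^ (suc D * j)              ≤⟨ *-monoˡ-≤ _ (^-monoʳ-≤ (suc D) (m≤n*m E (suc D))) ⟩
  suc D ^ (suc D * E) * suc D ^ (suc D * j)    ≡⟨ *-comm (suc D ^ (suc D * E)) _ ⟩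
  suc D ^ (suc D * j) * suc D ^ (suc D * E)    ≡⟨ sym (^-distribˡ-+-* (suc D) (suc D * j) (suc D * E)) ⟩
  suc D ^ (suc D * j + suc D * E)              ≡⟨ cong (suc D ^_) (sym (*-distribˡ-+ (suc D) j E)) ⟩
  suc D ^ (suc D * (j + E))                    ∎
  where open ≤-Reasoning

Values : (ℕ → ℕ) → ℕ → Set
Values a n = (i : ℕ) → i < n → Fin (a i)

encode : (a : ℕ → ℕ) (n : ℕ) → Values a n → Fin (prodUpTo a n)
encode a zero    f = Data.Fin.zero
encode a (suc n) f = combine (encode a n (λ i i<n → f i (m<n⇒m<1+n i<n))) (f n ≤-refl)

encode-injective : (a : ℕ → ℕ) (n : ℕ) (f g : Values a n) → encode a n f ≡ encode a n g →
                   ∀ i (i<n : i < n) → f i i<n ≡ g i i<n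
encode-injective a (suc n) f g same i i<1+n with combine-injective _ _ _ _ same | m<1+n⇒m<n∨m≡n i<1+n
... | sameInit , _ | inj₁ i<n =
  subst (λ lt → f i lt ≡ g i lt) (<-irrelevant (m<n⇒m<1+n i<n) i<1+n) (encode-injective a n _ _ sameInit i i<n)
... | _ , sameLast | inj₂ refl = subst (λ lt → f n lt ≡ g n lt) (<-irrelevant ≤-refl i<1+n) sameLast

prodUpTo-positive : (a : ℕ → ℕ) → ((n : ℕ) → 1 ≤ a n) → (n : ℕ) → 1 ≤ prodUpTo a n
prodUpTo-positive a a≥1 zero    = ≤-refl
prodUpTo-positive a a≥1 (suc n) = *-mono-≤ (prodUpTo-positive a a≥1 n) (a≥1 n)

allSubsets : (m : ℕ) → List (Subset m)
allSubsets zero    = [] ∷ []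
allSubsets (suc m) = map (inside ∷_) (allSubsets m) ++ map (outside ∷_) (allSubsets m)

∈-allSubsets : ∀ {m} (X : Subset m) → X ∈ allSubsets m
∈-allSubsets []            = here refl
∈-allSubsets (inside ∷ X)  = ∈-++⁺ˡ (∈-map⁺ (inside ∷_) (∈-allSubsets X))
∈-allSubsets {suc m} (outside ∷ X) = ∈-++⁺ʳ (map (inside ∷_) (allSubsets m)) (∈-map⁺ (outside ∷_) (∈-allSubsets X))

members : ∀ {m} → Family m → List (Subset m)
members {m} M = filter (λ X → M X BoolP.≟ true) (allSubsets m)

members-sound : ∀ {m} (M : Family m) {X} → X ∈ members M → M X ≡ true
members-sound {m} M X∈ = proj₂ (∈-filter⁻ (λ X → M X BoolP.≟ true) {xs = allSubsets m} X∈)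

members-complete : ∀ {m} (M : Family m) {X} → M X ≡ true → X ∈ members M
members-complete M {X} X∈M = ∈-filter⁺ (λ X → M X BoolP.≟ true) (∈-allSubsets X) X∈M

module Conditions (c h d : ℕ → ℕ) where

  Cond : Seq c → Set
  Cond = IsCond c h d

  sng : ∀ {m} → Subset m → Family m
  sng x X = ⌊ ≡-dec BoolP._≟_ X x ⌋

  sng-eq : ∀ {m} {x X : Subset m} → sng x X ≡ true → X ≡ x
  sng-eq {x = x} {X} = isYes-true (≡-dec BoolP._≟_ X x)

  sng-self : ∀ {m} (x : Subset m) → sng x x ≡ true
  sng-self x = isYes-intro (≡-dec BoolP._≟_ x x) refl

  NonEmpty : Seq c → Set
  NonEmpty s = (ℓ : ℕ) → Σ (Subset (c ℓ)) (λ X → s ℓ X ≡ true)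

  Agree : ℕ → Seq c → Seq c → Set
  Agree n s t = (ℓ : ℕ) → ℓ < n → (X : Subset (c ℓ)) → s ℓ X ≡ t ℓ X

  Agree-trans : ∀ {n} {s t u : Seq c} → Agree n s t → Agree n t u → Agree n s u
  Agree-trans s=t t=u ℓ ℓ<n X = trans (s=t ℓ ℓ<n X) (t=u ℓ ℓ<n X)

  ≤Q-refl : {s : Seq c} → s ≤Q s
  ≤Q-refl ℓ X X∈ = X∈

  ≤Q-trans : {s t u : Seq c} → s ≤Q t → t ≤Q u → s ≤Q u
  ≤Q-trans s≤t t≤u ℓ X X∈ = t≤u ℓ X (s≤t ℓ X X∈)

  -- Being a condition is checked levelwise: non-emptiness, the size bound (inherited
  -- from any condition above), and the norms, which only depend on a tail.
  cond-from : {s u t : Seq c} → NonEmpty s → s ≤Q u → Cond u → Cond t →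
              (B : ℕ) → (∀ ℓ → B ≤ ℓ → ∀ X → t ℓ X ≡ s ℓ X) → Cond s
  cond-from {s} {t = t} nonempty s≤u (_ , bounded , _) (_ , _ , norms) B sameTail =
    nonempty , (λ ℓ X X∈ → bounded ℓ X (s≤u ℓ X X∈)) , norms-s
    where
    norms-s : (r N : ℕ) → Σ ℕ (λ n → (N ≤ n) × NormdAbove (d n) (s n) r)
    norms-s r N with norms r (B ⊔ N)
    ... | n , B⊔N≤n , large = n , ≤-trans (m≤n⊔m B N) B⊔N≤n , NormdAbove-ext {D = d n} (sameTail n (≤-trans (m≤m⊔n B N) B⊔N≤n)) large

  Choice : ℕ → Set
  Choice n = (ℓ : ℕ) → ℓ < n → Subset (c ℓ)

  choice : ∀ {s : Seq c} {n} → Poss s n → Choice n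
  choice η ℓ ℓ<n = proj₁ (η ℓ ℓ<n)

  choice-irr : ∀ {s : Seq c} {n} (η : Poss s n) {ℓ} (lt lt' : ℓ < n) → choice η ℓ lt ≡ choice η ℓ lt'
  choice-irr η lt lt' = cong (choice η _) (<-irrelevant lt lt')

  In : Seq c → (n : ℕ) → Choice n → Set
  In s n t = (ℓ : ℕ) (ℓ<n : ℓ < n) → s ℓ (t ℓ ℓ<n) ≡ true

  toPoss : (s : Seq c) (n : ℕ) (t : Choice n) → In s n t → Poss s n
  toPoss s n t t∈ ℓ ℓ<n = t ℓ ℓ<n , t∈ ℓ ℓ<n

  _≈_ : ∀ {s : Seq c} {n} → Poss s n → Choice n → Set
  _≈_ {n = n} η t = (ℓ : ℕ) (ℓ<n : ℓ < n) → choice η ℓ ℓ<n ≡ t ℓ ℓ<n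

  widen : ∀ {s s' : Seq c} n → (∀ ℓ → ℓ < n → ∀ X → s ℓ X ≡ true → s' ℓ X ≡ true) → Poss s n → Poss s' n
  widen n s⊆s' η ℓ ℓ<n = choice η ℓ ℓ<n , s⊆s' ℓ ℓ<n _ (proj₂ (η ℓ ℓ<n))

  restrict : ∀ {s : Seq c} {n n'} → n' ≤ n → Poss s n → Poss s n'
  restrict n'≤n η ℓ ℓ<n' = η ℓ (<-≤-trans ℓ<n' n'≤n)

  Below : Seq c → Seq c → (n : ℕ) → Choice n → Set
  Below u s n t = (∀ ℓ (ℓ<n : ℓ < n) X → u ℓ X ≡ true → X ≡ t ℓ ℓ<n) ×
                  (∀ ℓ → ¬ ℓ < n → ∀ X → u ℓ X ≡ true → s ℓ X ≡ true)

  below⇒≤wedge : ∀ {u s : Seq c} n (η : Poss s n) → Below u s n (choice η) → u ≤Q wedge s n η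
  below⇒≤wedge n η (low , high) ℓ X X∈ with ℓ <? n
  ... | yes ℓ<n = isYes-intro (≡-dec BoolP._≟_ X _) (low ℓ ℓ<n X X∈)
  ... | no  ℓ≮n = high ℓ ℓ≮n X X∈

  ≤wedge⇒below : ∀ {u s : Seq c} n (η : Poss s n) → u ≤Q wedge s n η → Below u s n (choice η)
  ≤wedge⇒below {u} {s} n η u≤ = low , high
    where
    low : ∀ ℓ (ℓ<n : ℓ < n) X → u ℓ X ≡ true → X ≡ choice η ℓ ℓ<n
    low ℓ ℓ<n X X∈ with ℓ <? n | u≤ ℓ X X∈
    ... | yes lt | X∈w = trans (sng-eq X∈w) (choice-irr η lt ℓ<n)
    ... | no ℓ≮n | _   = ⊥-elim (ℓ≮n ℓ<n)
    high : ∀ ℓ → ¬ ℓ < n → ∀ X → u ℓ X ≡ true → s ℓ X ≡ true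
    high ℓ ℓ≮n X X∈ with ℓ <? n | u≤ ℓ X X∈
    ... | yes ℓ<n | _   = ⊥-elim (ℓ≮n ℓ<n)
    ... | no _    | X∈s = X∈s

  below-contains : ∀ {u s : Seq c} {n t} → NonEmpty u → Below u s n t → In u n t
  below-contains {u} nonempty (low , _) ℓ ℓ<n =
    subst (λ X → u ℓ X ≡ true) (low ℓ ℓ<n _ (proj₂ (nonempty ℓ))) (proj₂ (nonempty ℓ))

  wedge-≤ : ∀ {s : Seq c} n (η : Poss s n) → wedge s n η ≤Q s
  wedge-≤ {s} n η ℓ X X∈ with ℓ <? n
  ... | yes ℓ<n = subst (λ Y → s ℓ Y ≡ true) (sym (sng-eq X∈)) (proj₂ (η ℓ ℓ<n))
  ... | no  _   = X∈

  wedge-mono : ∀ {s s' : Seq c} n (η : Poss s n) (η' : Poss s' n) →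
               (∀ ℓ → ¬ ℓ < n → ∀ X → s ℓ X ≡ true → s' ℓ X ≡ true) → η ≈ choice η' →
               wedge s n η ≤Q wedge s' n η'
  wedge-mono {s} n η η' tail⊆ sameChoice with ≤wedge⇒below n η (≤Q-refl {wedge s n η})
  ... | low , high = below⇒≤wedge n η'
        ((λ ℓ ℓ<n X X∈ → trans (low ℓ ℓ<n X X∈) (sameChoice ℓ ℓ<n)) ,
         (λ ℓ ℓ≮n X X∈ → tail⊆ ℓ ℓ≮n X (high ℓ ℓ≮n X X∈)))

  wedge-high : ∀ {s : Seq c} n (η : Poss s n) ℓ → ¬ ℓ < n → ∀ X → wedge s n η ℓ X ≡ s ℓ X
  wedge-high n η ℓ ℓ≮n X with ℓ <? n
  ... | yes ℓ<n = ⊥-elim (ℓ≮n ℓ<n)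
  ... | no  _   = refl

  wedge-chosen : ∀ {s : Seq c} n (η : Poss s n) ℓ (ℓ<n : ℓ < n) → wedge s n η ℓ (choice η ℓ ℓ<n) ≡ true
  wedge-chosen n η ℓ ℓ<n with ℓ <? n
  ... | yes lt  = isYes-intro (≡-dec BoolP._≟_ _ _) (choice-irr η ℓ<n lt)
  ... | no  ℓ≮n = ⊥-elim (ℓ≮n ℓ<n)

  wedge-cond : ∀ {s : Seq c} n (η : Poss s n) → Cond s → Cond (wedge s n η)
  wedge-cond {s} n η cs = cond-from nonempty (wedge-≤ n η) cs cs n (λ ℓ n≤ℓ X → sym (wedge-high n η ℓ (≤⇒≯ n≤ℓ) X))
    where
    nonempty : NonEmpty (wedge s n η)
    nonempty ℓ with ℓ <? n
    ... | yes ℓ<n = choice η ℓ ℓ<n , sng-self _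
    ... | no  _   = proj₁ cs ℓ

  glue : Seq c → Seq c → ℕ → Seq c
  glue s t n ℓ with ℓ <? n
  ... | yes _ = s ℓ
  ... | no  _ = t ℓ

  glue-low : ∀ (s t : Seq c) n → Agree n s (glue s t n)
  glue-low s t n ℓ ℓ<n X with ℓ <? n
  ... | yes _   = refl
  ... | no  ℓ≮n = ⊥-elim (ℓ≮n ℓ<n)

  glue-high : ∀ (s t : Seq c) n ℓ → ¬ ℓ < n → ∀ X → glue s t n ℓ X ≡ t ℓ X
  glue-high s t n ℓ ℓ≮n X with ℓ <? n
  ... | yes ℓ<n = ⊥-elim (ℓ≮n ℓ<n)
  ... | no  _   = refl

  glue-≤ : ∀ {s t : Seq c} n → t ≤Q s → glue s t n ≤Q s
  glue-≤ n t≤s ℓ X X∈ with ℓ <? n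
  ... | yes _ = X∈
  ... | no  _ = t≤s ℓ X X∈

  glue-cond : ∀ {s t : Seq c} n → Cond s → Cond t → t ≤Q s → Cond (glue s t n)
  glue-cond {s} {t} n cs ct t≤s =
    cond-from nonempty (glue-≤ n t≤s) cs ct n (λ ℓ n≤ℓ X → sym (glue-high s t n ℓ (≤⇒≯ n≤ℓ) X))
    where
    nonempty : NonEmpty (glue s t n)
    nonempty ℓ with ℓ <? n
    ... | yes _ = proj₁ cs ℓ
    ... | no  _ = proj₁ ct ℓ

  patch : Seq c → (k : ℕ) → Family (c k) → Seq c
  patch s k M ℓ with ℓ ≟ k
  ... | yes refl = M
  ... | no  _    = s ℓ

  patch-at : ∀ (s : Seq c) k M X → patch s k M k X ≡ M X
  patch-at s k M X with k ≟ k
  ... | yes refl = refl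
  ... | no  k≢k  = ⊥-elim (k≢k refl)

  patch-off : ∀ (s : Seq c) k M ℓ → ℓ ≢ k → ∀ X → patch s k M ℓ X ≡ s ℓ X
  patch-off s k M ℓ ℓ≢k X with ℓ ≟ k
  ... | yes ℓ≡k = ⊥-elim (ℓ≢k ℓ≡k)
  ... | no  _   = refl

  patch-≤ : ∀ {s : Seq c} {k M} → (∀ X → M X ≡ true → s k X ≡ true) → patch s k M ≤Q s
  patch-≤ {k = k} M⊆ ℓ X X∈ with ℓ ≟ k
  ... | yes refl = M⊆ X X∈
  ... | no  _    = X∈

  patch-cond : ∀ {s : Seq c} {k M} → Cond s → Σ (Subset (c k)) (λ X → M X ≡ true) →
               (∀ X → M X ≡ true → s k X ≡ true) → Cond (patch s k M)
  patch-cond {s} {k} {M} cs inM M⊆ =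
    cond-from nonempty (patch-≤ M⊆) cs cs (suc k) (λ ℓ k<ℓ X → sym (patch-off s k M ℓ (>⇒≢ k<ℓ) X))
    where
    nonempty : NonEmpty (patch s k M)
    nonempty ℓ with ℓ ≟ k
    ... | yes refl = inM
    ... | no  _    = proj₁ cs ℓ

  snoc : ∀ {n} → Choice n → Subset (c n) → Choice (suc n)
  snoc t x ℓ ℓ<1+n with m<1+n⇒m<n∨m≡n ℓ<1+n
  ... | inj₁ ℓ<n  = t ℓ ℓ<n
  ... | inj₂ refl = x

  snoc-In : ∀ {s : Seq c} {n} (t : Choice n) x → In s n t → s n x ≡ true → In s (suc n) (snoc t x)
  snoc-In {s} t x t∈ x∈ ℓ ℓ<1+n with m<1+n⇒m<n∨m≡n ℓ<1+n
  ... | inj₁ ℓ<n  = t∈ ℓ ℓ<n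
  ... | inj₂ refl = x∈

  possibilities : Seq c → (n : ℕ) → List (Choice n)
  possibilities s zero    = (λ ℓ ()) ∷ []
  possibilities s (suc n) = cartesianProductWith snoc (possibilities s n) (members (s n))

  possibilities-sound : ∀ (s : Seq c) n {t} → t ∈ possibilities s n → In s n t
  possibilities-sound s (suc n) t∈ with ∈-cartesianProductWith⁻ snoc (possibilities s n) (members (s n)) t∈
  ... | t' , x , t'∈ , x∈ , refl = snoc-In t' x (possibilities-sound s n t'∈) (members-sound (s n) x∈)

  possibilities-complete : ∀ (s : Seq c) n (η : Poss s n) → Σ (Choice n) (λ t → (t ∈ possibilities s n) × (η ≈ t))
  possibilities-complete s zero η = _ , here refl , λ ℓ ()
  possibilities-complete s (suc n) η with possibilities-complete s n (λ ℓ ℓ<n → η ℓ (m<n⇒m<1+n ℓ<n))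
  ... | t , t∈ , η≈t =
    snoc t x , ∈-cartesianProductWith⁺ snoc t∈ (members-complete (s n) (proj₂ (η n ≤-refl))) , η≈snoc
    where
    x : Subset (c n)
    x = choice η n ≤-refl
    η≈snoc : η ≈ snoc t x
    η≈snoc ℓ ℓ<1+n with m<1+n⇒m<n∨m≡n ℓ<1+n
    ... | inj₁ ℓ<n  = trans (choice-irr η ℓ<1+n _) (η≈t ℓ ℓ<n)
    ... | inj₂ refl = choice-irr η ℓ<1+n ≤-refl

  module Reading {a : ℕ → ℕ} (τ : Name c h d a) where
    open Name τ

    Decides-mono : ∀ {u u' : Seq c} {n} → Cond u → Cond u' → u' ≤Q u → Decides τ u n → Decides τ u' n
    Decides-mono cu cu' u'≤u (f , forces) = f , λ i i<n → mono _ _ i (f i i<n) cu cu' u'≤u (forces i i<n)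

    Decides-restrict : ∀ {u : Seq c} {n n'} → n' ≤ n → Decides τ u n → Decides τ u n'
    Decides-restrict n'≤n (f , forces) = (λ i i<n' → f i (<-≤-trans i<n' n'≤n)) , λ i i<n' → forces i (<-≤-trans i<n' n'≤n)

    reads-stronger : ∀ {s s' : Seq c} n → Cond s → Cond s' → s' ≤Q s →
                     ((η : Poss s n) → Decides τ (wedge s n η) n) → (η : Poss s' n) → Decides τ (wedge s' n η) n
    reads-stronger n cs cs' s'≤s reads η =
      Decides-mono (wedge-cond n η' cs) (wedge-cond n η cs') (wedge-mono n η η' (λ ℓ _ → s'≤s ℓ) (λ ℓ ℓ<n → refl)) (reads η')
      where
      η' = widen n (λ ℓ _ → s'≤s ℓ) η

    decide-dense : (n : ℕ) (u : Seq c) → Cond u → Σ (Seq c) (λ u' → Cond u' × (u' ≤Q u) × Decides τ u' n)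
    decide-dense zero    u cu = u , cu , ≤Q-refl , (λ i ()) , λ i ()
    decide-dense (suc n) u cu with decide-dense n u cu
    ... | u₁ , cu₁ , u₁≤u , f , forces with dense u₁ n cu₁
    ... | u₂ , cu₂ , u₂≤u₁ , x , forcesx = u₂ , cu₂ , ≤Q-trans u₂≤u₁ u₁≤u , f' , forces'
      where
      f' : Values a (suc n)
      f' i i<1+n with m<1+n⇒m<n∨m≡n i<1+n
      ... | inj₁ i<n  = f i i<n
      ... | inj₂ refl = x
      forces' : (i : ℕ) (i<1+n : i < suc n) → Forces u₂ i (f' i i<1+n)
      forces' i i<1+n with m<1+n⇒m<n∨m≡n i<1+n
      ... | inj₁ i<n  = mono u₁ u₂ i _ cu₁ cu₂ u₂≤u₁ (forces i i<n)
      ... | inj₂ refl = forcesx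

    DecidedAt : Seq c → (n : ℕ) → Choice n → Set
    DecidedAt s n t = (t∈ : In s n t) → Decides τ (wedge s n (toPoss s n t t∈)) n

    DecidedAt-mono : ∀ {s s' : Seq c} {n t} → Cond s → Cond s' → s' ≤Q s → DecidedAt s n t → DecidedAt s' n t
    DecidedAt-mono {s} {s'} {n} {t} cs cs' s'≤s decided t∈' =
      Decides-mono (wedge-cond n η cs) (wedge-cond n η' cs')
                   (wedge-mono n η' η (λ ℓ _ → s'≤s ℓ) (λ ℓ ℓ<n → refl)) (decided t∈)
      where
      t∈ : In s n t
      t∈ ℓ ℓ<n = s'≤s ℓ _ (t∈' ℓ ℓ<n)
      η = toPoss s n t t∈
      η' = toPoss s' n t t∈'

    decide-at : ∀ {s : Seq c} n t → Cond s → In s n t →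
                Σ (Seq c) (λ s' → Cond s' × (s' ≤Q s) × Agree n s s' × DecidedAt s' n t)
    decide-at {s} n t cs t∈ with decide-dense n (wedge s n (toPoss s n t t∈)) (wedge-cond n (toPoss s n t t∈) cs)
    ... | u , cu , u≤wedge , decided =
      glue s u n , glue-cond n cs cu u≤s , u≤s' , glue-low s u n , decided'
      where
      η = toPoss s n t t∈
      u≤s : u ≤Q s
      u≤s = ≤Q-trans u≤wedge (wedge-≤ n η)
      u≤s' : glue s u n ≤Q s
      u≤s' = glue-≤ n u≤s
      -- below n, u consists of the singletons {t ℓ}; from n on, glue s u n is u.
      t∈u : In u n t
      t∈u = below-contains (proj₁ cu) (≤wedge⇒below n η u≤wedge)
      decided' : DecidedAt (glue s u n) n t
      decided' t∈' =
        Decides-mono cu (wedge-cond n η' (glue-cond n cs cu u≤s))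
          (≤Q-trans (wedge-mono n η' ηu (λ ℓ ℓ≮n X X∈ → trans (sym (glue-high s u n ℓ ℓ≮n X)) X∈) (λ ℓ ℓ<n → refl))
                    (wedge-≤ n ηu))
          decided
        where
        η' = toPoss (glue s u n) n t t∈'
        ηu = toPoss u n t t∈u

    decide-list : ∀ {s : Seq c} n (L : List (Choice n)) → Cond s → (∀ t → t ∈ L → In s n t) →
                  Σ (Seq c) (λ s' → Cond s' × (s' ≤Q s) × Agree n s s' × (∀ t → t ∈ L → DecidedAt s' n t))
    decide-list {s} n [] cs _ = s , cs , ≤Q-refl , (λ ℓ _ X → refl) , λ t ()
    decide-list {s} n (t ∷ L) cs L⊆s with decide-at n t cs (L⊆s t (here refl))
    ... | s₁ , cs₁ , s₁≤s , s=s₁ , decided₁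
      with decide-list n L cs₁ (λ t' t'∈ ℓ ℓ<n → trans (sym (s=s₁ ℓ ℓ<n _)) (L⊆s t' (there t'∈) ℓ ℓ<n))
    ... | s₂ , cs₂ , s₂≤s₁ , s₁=s₂ , decided₂ =
      s₂ , cs₂ , ≤Q-trans s₂≤s₁ s₁≤s , Agree-trans s=s₁ s₁=s₂ , decided
      where
      decided : ∀ t' → t' ∈ t ∷ L → DecidedAt s₂ n t'
      decided .t (here refl) = DecidedAt-mono cs₁ cs₂ s₂≤s₁ decided₁
      decided t' (there t'∈) = decided₂ t' t'∈

    decide-all : ∀ {s : Seq c} n → Cond s →
                 Σ (Seq c) (λ s' → Cond s' × (s' ≤Q s) × Agree n s s' × ((η : Poss s' n) → Decides τ (wedge s' n η) n))
    decide-all {s} n cs with decide-list n (possibilities s n) cs (λ t → possibilities-sound s n)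
    ... | s' , cs' , s'≤s , s=s' , decided = s' , cs' , s'≤s , s=s' , decided-all
      where
      decided-all : (η : Poss s' n) → Decides τ (wedge s' n η) n
      decided-all η with possibilities-complete s n (widen n (λ ℓ ℓ<n X X∈ → trans (s=s' ℓ ℓ<n X) X∈) η)
      ... | t , t∈ , η≈t =
        Decides-mono (wedge-cond n ηt cs') (wedge-cond n η cs')
                     (wedge-mono n η ηt (λ ℓ _ X X∈ → X∈) η≈t) (decided t t∈ t∈s')
        where
        t∈s' : In s' n t
        t∈s' ℓ ℓ<n = subst (λ X → s' ℓ X ≡ true) (η≈t ℓ ℓ<n) (proj₂ (η ℓ ℓ<n))
        ηt = toPoss s' n t t∈s'

module EarlyReading (c h d a : ℕ → ℕ) (h<c : (n : ℕ) → h n < c n) (d≥2 : (n : ℕ) → 2 ≤ d n)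
                    (a≥1 : (n : ℕ) → 1 ≤ a n) (∏A≤d : (n : ℕ) → prodUpTo a n ≤ d n) (τ : Name c h d a) where

  open Conditions c h d
  open Reading τ
  open Name τ using (Forces; closed; mono)

  record Stage : Set where
    field
      r      : Seq c
      r-cond : Cond r
      front  : ℕ
      reads  : (n : ℕ) → n ≤ front → (η : Poss r n) → Decides τ (wedge r n η) n

  record Successor (j : ℕ) (S : Stage) : Set where
    open Stage
    field
      next        : Stage
      next-≤      : r next ≤Q r S
      next-agrees : Agree (front S) (r S) (r next)
      next-grows  : suc (front S) ≤ front next
      wide        : ℕ
      wide-from   : front S ≤ wide
      wide-below  : wide < front next
      wide-norm   : NormdAbove (d wide) (r next wide) j

  count : Stage → ℕ
  count S = length (possibilities (Stage.r S) (Stage.front S))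

  wideLevel : (j : ℕ) (S : Stage) → Σ ℕ (λ k → (Stage.front S ≤ k) × NormdAbove (d k) (Stage.r S k) (j + count S))
  wideLevel j S = proj₂ (proj₂ (Stage.r-cond S)) (j + count S) (Stage.front S)

  module Step (j : ℕ) (S : Stage) (k : ℕ) (front≤k : Stage.front S ≤ k)
              (r-wide : NormdAbove (d k) (Stage.r S k) (j + count S)) where
    open Stage S

    E : ℕ
    E = count S

    base : Poss r k
    base ℓ _ = proj₁ r-cond ℓ

    r₁ : Seq c
    r₁ = glue r (wedge r k base) front

    r₁≤r : r₁ ≤Q r
    r₁≤r = glue-≤ front (wedge-≤ k base)

    r₁-cond : Cond r₁
    r₁-cond = glue-cond front r-cond (wedge-cond k base r-cond) (wedge-≤ k base)

    r₁-at-k : ∀ X → r₁ k X ≡ r k X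
    r₁-at-k X = trans (glue-high r _ front k (≤⇒≯ front≤k) X) (wedge-high k base k (<-irrefl refl) X)

    r₁-middle : ∀ ℓ → front ≤ ℓ → (ℓ<k : ℓ < k) → ∀ X → r₁ ℓ X ≡ true → X ≡ choice base ℓ ℓ<k
    r₁-middle ℓ front≤ℓ ℓ<k X X∈ =
      proj₁ (≤wedge⇒below k base (≤Q-refl {wedge r k base})) ℓ ℓ<k X
            (trans (sym (glue-high r _ front ℓ (≤⇒≯ front≤ℓ) X)) X∈)

    r₁-middle-base : ∀ ℓ → front ≤ ℓ → (ℓ<k : ℓ < k) → r₁ ℓ (choice base ℓ ℓ<k) ≡ true
    r₁-middle-base ℓ front≤ℓ ℓ<k = trans (glue-high r _ front ℓ (≤⇒≯ front≤ℓ) _) (wedge-chosen k base ℓ ℓ<k)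

    fill : Choice front → Choice k
    fill t ℓ ℓ<k with ℓ <? front
    ... | yes ℓ<front = t ℓ ℓ<front
    ... | no  _       = choice base ℓ ℓ<k

    fill-In : ∀ t → In r front t → In r₁ k (fill t)
    fill-In t t∈ ℓ ℓ<k with ℓ <? front
    ... | yes ℓ<front = t∈ ℓ ℓ<front
    ... | no  _       = wedge-chosen k base ℓ ℓ<k

    fill-unique : ∀ {s : Seq c} → s ≤Q r₁ → (η : Poss s k) (t : Choice front) → restrict front≤k η ≈ t → η ≈ fill t
    fill-unique s≤r₁ η t η≈t ℓ ℓ<k with ℓ <? front
    ... | yes ℓ<front = trans (choice-irr η ℓ<k _) (η≈t ℓ ℓ<front)
    ... | no  ℓ≮front = r₁-middle ℓ (≮⇒≥ ℓ≮front) ℓ<k _ (s≤r₁ ℓ _ (proj₂ (η ℓ ℓ<k)))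

    -- 2. Decide τ↾(k+1) above every possibility below k+1, keeping levels ≤ k.
    -- (Abstract: only the stated properties are used, and unfolding is costly.)
    abstract
     decided : Σ (Seq c) (λ s → Cond s × (s ≤Q r₁) × Agree (suc k) r₁ s ×
                                 ((η : Poss s (suc k)) → Decides τ (wedge s (suc k) η) (suc k)))
     decided = decide-all (suc k) r₁-cond

    r₂ : Seq c
    r₂ = proj₁ decided

    r₂-cond : Cond r₂
    r₂-cond = proj₁ (proj₂ decided)

    r₂≤r₁ : r₂ ≤Q r₁
    r₂≤r₁ = proj₁ (proj₂ (proj₂ decided))

    r₁=r₂ : Agree (suc k) r₁ r₂
    r₁=r₂ = proj₁ (proj₂ (proj₂ (proj₂ decided)))

    r₂-reads : (η : Poss r₂ (suc k)) → Decides τ (wedge r₂ (suc k) η) (suc k)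
    r₂-reads = proj₂ (proj₂ (proj₂ (proj₂ decided)))

    extend : ∀ {t} → t ∈ possibilities r front → ∀ x → r₁ k x ≡ true → Poss r₂ (suc k)
    extend {t} t∈ x x∈ = toPoss r₂ (suc k) (snoc (fill t) x) λ ℓ ℓ<1+k →
      trans (sym (r₁=r₂ ℓ ℓ<1+k _)) (snoc-In {r₁} (fill t) x (fill-In t (possibilities-sound r front t∈)) x∈ ℓ ℓ<1+k)

    value : ∀ {t} → t ∈ possibilities r front → ∀ x → r₁ k x ≡ true → Values a k
    value t∈ x x∈ i i<k = proj₁ (r₂-reads (extend t∈ x x∈)) i (m<n⇒m<1+n i<k)

    Colours : ℕ
    Colours = prodUpTo a k

    colour : ∀ t → t ∈ possibilities r front → Subset (c k) → Fin Colours
    colour t t∈ x = ifTrue (r₁ k x) (λ x∈ → encode a k (value t∈ x x∈)) (fromℕ< (prodUpTo-positive a a≥1 k))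

    -- The target norm: ‖·‖^d > j means covering K.
    K : ℕ
    K = d k ^ (d k * j)

    r₁-covers : Covers (r₁ k) (Colours ^ E * K)
    r₁-covers = Covers-mono (λ X X∈ → trans (r₁-at-k X) X∈)
                            (colours-cost Colours (d k) j E (∏A≤d k) (≤-trans (s≤s z≤n) (d≥2 k)))
                            (NormdAbove-toCovers (d k) (r k) (j + E) r-wide)

    -- The homogeneous subfamily M of r₁(k) (abstract for the same reason as above).
    abstract
     homogeneous : Σ (Family (c k)) (λ M → (∀ X → M X ≡ true → r₁ k X ≡ true) × Covers M K ×
                     (∀ t (t∈ : t ∈ possibilities r front) → Σ (Fin Colours) (λ w → ∀ X → M X ≡ true → colour t t∈ X ≡ w)))
     homogeneous = homogenise Colours (possibilities r front) colour (r₁ k) K r₁-covers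

    M : Family (c k)
    M = proj₁ homogeneous

    M⊆r₁ : ∀ X → M X ≡ true → r₁ k X ≡ true
    M⊆r₁ = proj₁ (proj₂ homogeneous)

    M-covers : Covers M K
    M-covers = proj₁ (proj₂ (proj₂ homogeneous))

    M-constant : ∀ t (t∈ : t ∈ possibilities r front) → Σ (Fin Colours) (λ w → ∀ X → M X ≡ true → colour t t∈ X ≡ w)
    M-constant = proj₂ (proj₂ (proj₂ homogeneous))

    M-same-value : ∀ {t} (t∈ : t ∈ possibilities r front) x y (x∈ : M x ≡ true) (y∈ : M y ≡ true) →
                   ∀ i (i<k : i < k) → value t∈ x (M⊆r₁ x x∈) i i<k ≡ value t∈ y (M⊆r₁ y y∈) i i<k
    M-same-value {t} t∈ x y x∈ y∈ = encode-injective a k _ _ (begin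
      encode a k (value t∈ x (M⊆r₁ x x∈))  ≡⟨ sym (ifTrue-true (r₁ k x) _ _ (M⊆r₁ x x∈)) ⟩
      colour t t∈ x                        ≡⟨ proj₂ (M-constant t t∈) x x∈ ⟩
      proj₁ (M-constant t t∈)              ≡⟨ sym (proj₂ (M-constant t t∈) y y∈) ⟩
      colour t t∈ y                        ≡⟨ ifTrue-true (r₁ k y) _ _ (M⊆r₁ y y∈) ⟩
      encode a k (value t∈ y (M⊆r₁ y y∈))  ∎)
      where open ≡-Reasoning

    r₃ : Seq c
    r₃ = patch r₂ k M

    M⊆r₂ : ∀ X → M X ≡ true → r₂ k X ≡ true
    M⊆r₂ X X∈ = trans (sym (r₁=r₂ k ≤-refl X)) (M⊆r₁ X X∈)

    r₃-cond : Cond r₃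
    r₃-cond = patch-cond r₂-cond (Covers-nonempty M-covers) M⊆r₂

    r₃≤r₂ : r₃ ≤Q r₂
    r₃≤r₂ = patch-≤ M⊆r₂

    r₃≤r₁ : r₃ ≤Q r₁
    r₃≤r₁ = ≤Q-trans r₃≤r₂ r₂≤r₁

    r₃≤r : r₃ ≤Q r
    r₃≤r = ≤Q-trans r₃≤r₁ r₁≤r

    r₁=r₃ : Agree k r₁ r₃
    r₁=r₃ ℓ ℓ<k X = trans (r₁=r₂ ℓ (m<n⇒m<1+n ℓ<k) X) (sym (patch-off r₂ k M ℓ (<⇒≢ ℓ<k) X))

    r₃-norm : NormdAbove (d k) (r₃ k) j
    r₃-norm = NormdAbove-ext {D = d k} (λ X → sym (patch-at r₂ k M X)) (NormdAbove-fromCovers (d k) M j proper M-covers)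
      where
      proper : ∀ X → M X ≡ true → ∣ X ∣ < c k
      proper X X∈ = ≤-<-trans (proj₁ (proj₂ r-cond) k X (r₁≤r k X (M⊆r₁ X X∈))) (h<c k)

    -- 4. Reading.  Below r₃ ∧ η (η ∈ poss(r₃,<k) continuing t), fixing level k to any
    -- single x gives a condition below r₂ ∧ (fill t ⌢ x), with x ∈ M.
    fix-level-k : ∀ {t} (t∈ : t ∈ possibilities r front) (η : Poss r₃ k) → η ≈ fill t →
                  (q : Seq c) → Cond q → q ≤Q wedge r₃ k η →
                  Σ (Subset (c k)) (λ x → Σ (M x ≡ true) (λ x∈ →
                    Σ (Seq c) (λ q' → Cond q' × (q' ≤Q q) × (q' ≤Q wedge r₂ (suc k) (extend t∈ x (M⊆r₁ x x∈))))))
    fix-level-k {t} t∈ η η≈fill q cq q≤ = x , x∈M , q' , patch-cond cq (x , sng-self x) x⊆q , patch-≤ x⊆q ,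
                                          below⇒≤wedge (suc k) (extend t∈ x (M⊆r₁ x x∈M)) (low , high)
      where
      x : Subset (c k)
      x = proj₁ (proj₁ cq k)
      q-below : Below q r₃ k (choice η)
      q-below = ≤wedge⇒below k η q≤
      x∈M : M x ≡ true
      x∈M = trans (sym (patch-at r₂ k M x)) (proj₂ q-below k (<-irrefl refl) x (proj₂ (proj₁ cq k)))
      x⊆q : ∀ X → sng x X ≡ true → q k X ≡ true
      x⊆q X X∈ = subst (λ Y → q k Y ≡ true) (sym (sng-eq X∈)) (proj₂ (proj₁ cq k))
      q' : Seq c
      q' = patch q k (sng x)
      low : ∀ ℓ (ℓ<1+k : ℓ < suc k) X → q' ℓ X ≡ true → X ≡ snoc (fill t) x ℓ ℓ<1+k
      low ℓ ℓ<1+k X X∈ with m<1+n⇒m<n∨m≡n ℓ<1+k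
      ... | inj₁ ℓ<k  = trans (proj₁ q-below ℓ ℓ<k X (trans (sym (patch-off q k _ ℓ (<⇒≢ ℓ<k) X)) X∈)) (η≈fill ℓ ℓ<k)
      ... | inj₂ refl = sng-eq (trans (sym (patch-at q k _ X)) X∈)
      high : ∀ ℓ → ¬ ℓ < suc k → ∀ X → q' ℓ X ≡ true → r₂ ℓ X ≡ true
      high ℓ ℓ≮1+k X X∈ = r₃≤r₂ ℓ X (proj₂ q-below ℓ (λ ℓ<k → ℓ≮1+k (m<n⇒m<1+n ℓ<k)) X
                                 (trans (sym (patch-off q k _ ℓ (λ { refl → ℓ≮1+k ≤-refl }) X)) X∈))

    -- The heart of the step: r₃ ∧ η decides τ↾k, by homogeneity of M and closure of forcing.
    reads-k : (η : Poss r₃ k) → Decides τ (wedge r₃ k η) k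
    reads-k η = value t∈ x₀ (M⊆r₁ x₀ x₀∈) , forced
      where
      η↾front : Poss r front
      η↾front = restrict front≤k (widen k (λ ℓ _ → r₃≤r ℓ) η)
      t : Choice front
      t = proj₁ (possibilities-complete r front η↾front)
      t∈ : t ∈ possibilities r front
      t∈ = proj₁ (proj₂ (possibilities-complete r front η↾front))
      η≈fill : η ≈ fill t
      η≈fill = fill-unique r₃≤r₁ η t (proj₂ (proj₂ (possibilities-complete r front η↾front)))
      x₀ : Subset (c k)
      x₀ = proj₁ (Covers-nonempty M-covers)
      x₀∈ : M x₀ ≡ true
      x₀∈ = proj₂ (Covers-nonempty M-covers)
      forced : (i : ℕ) (i<k : i < k) → Forces (wedge r₃ k η) i (value t∈ x₀ (M⊆r₁ x₀ x₀∈) i i<k)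
      forced i i<k = closed _ i _ (wedge-cond k η r₃-cond) densely
        where
        densely : (q : Seq c) → Cond q → q ≤Q wedge r₃ k η →
                  Σ (Seq c) (λ q' → Cond q' × (q' ≤Q q) × Forces q' i (value t∈ x₀ (M⊆r₁ x₀ x₀∈) i i<k))
        densely q cq q≤ with fix-level-k t∈ η η≈fill q cq q≤
        ... | x , x∈ , q' , cq' , q'≤q , q'≤ext =
          q' , cq' , q'≤q , subst (Forces q' i) (M-same-value t∈ x x₀ x∈ x₀∈ i i<k)
            (mono _ q' i _ (wedge-cond (suc k) _ r₂-cond) cq' q'≤ext
                  (proj₂ (r₂-reads (extend t∈ x (M⊆r₁ x x∈))) i (m<n⇒m<1+n i<k)))

    -- Between the fronts: extend η by the base choices up to k and use reads-k.
    reads-middle : ∀ n → front < n → n ≤ k → (η : Poss r₃ n) → Decides τ (wedge r₃ n η) n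
    reads-middle n front<n n≤k η =
      Decides-restrict n≤k (Decides-mono (wedge-cond k η⁺ r₃-cond) (wedge-cond n η r₃-cond)
                                         (below⇒≤wedge k η⁺ (low , high)) (reads-k η⁺))
      where
      η⁺ : Poss r₃ k
      η⁺ ℓ ℓ<k with ℓ <? n
      ... | yes ℓ<n = η ℓ ℓ<n
      ... | no  ℓ≮n = choice base ℓ ℓ<k ,
                      trans (sym (r₁=r₃ ℓ ℓ<k _)) (r₁-middle-base ℓ (≤-trans (<⇒≤ front<n) (≮⇒≥ ℓ≮n)) ℓ<k)
      low : ∀ ℓ (ℓ<k : ℓ < k) X → wedge r₃ n η ℓ X ≡ true → X ≡ choice η⁺ ℓ ℓ<k
      low ℓ ℓ<k X X∈ with ℓ <? n
      ... | yes ℓ<n = sng-eq X∈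
      ... | no  ℓ≮n = r₁-middle ℓ (≤-trans (<⇒≤ front<n) (≮⇒≥ ℓ≮n)) ℓ<k X (r₃≤r₁ ℓ X X∈)
      high : ∀ ℓ → ¬ ℓ < k → ∀ X → wedge r₃ n η ℓ X ≡ true → r₃ ℓ X ≡ true
      high ℓ ℓ≮k X X∈ = trans (sym (wedge-high n η ℓ (λ ℓ<n → ℓ≮k (<-≤-trans ℓ<n n≤k)) X)) X∈

    reads-next : (n : ℕ) → n ≤ suc k → (η : Poss r₃ n) → Decides τ (wedge r₃ n η) n
    reads-next n n≤1+k with n ≤? front | m≤n⇒m<n∨m≡n n≤1+k
    -- up to the old front, the old stage already reads τ
    ... | yes n≤front | _          = reads-stronger n r-cond r₃-cond r₃≤r (reads n n≤front)
    ... | no  n≰front | inj₁ n<1+k = reads-middle n (≰⇒> n≰front) (≤-pred n<1+k)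
    -- at the new front k+1, r₂ was built to read τ
    ... | no  _       | inj₂ refl  = reads-stronger (suc k) r₂-cond r₃-cond r₃≤r₂ r₂-reads
    successor : Successor j S
    successor = record
      { next        = record { r = r₃ ; r-cond = r₃-cond ; front = suc k ; reads = reads-next }
      ; next-≤      = r₃≤r
      ; next-agrees = λ ℓ ℓ<front X → trans (glue-low r _ front ℓ ℓ<front X) (r₁=r₃ ℓ (<-≤-trans ℓ<front front≤k) X)
      ; next-grows  = s≤s front≤k
      ; wide        = k
      ; wide-from   = front≤k
      ; wide-below  = ≤-refl
      ; wide-norm   = r₃-norm
      }

  stage₀ : (p : Seq c) → Cond p → Stage
  stage₀ p cp = record { r = p ; r-cond = cp ; front = 0 ; reads = λ { zero _ η → (λ i ()) , (λ i ()) } }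

  step : (j : ℕ) (S : Stage) → Successor j S
  step j S = Step.successor j S (proj₁ w) (proj₁ (proj₂ w)) (proj₂ (proj₂ w))
    where
    w = wideLevel j S

  module Fusion (p : Seq c) (cp : Cond p) where
    stage : ℕ → Stage
    stage zero    = stage₀ p cp
    stage (suc j) = Successor.next (step j (stage j))

    R : ℕ → Seq c
    R j = Stage.r (stage j)

    F : ℕ → ℕ
    F j = Stage.front (stage j)

    F-grows : ∀ j → j ≤ F j
    F-grows zero    = z≤n
    F-grows (suc j) = ≤-trans (s≤s (F-grows j)) (Successor.next-grows (step j (stage j)))

    F-mono : ∀ {i j} → i ≤′ j → F i ≤ F j
    F-mono ≤′-refl         = ≤-refl
    F-mono (≤′-step {j} i≤′j) = ≤-trans (F-mono i≤′j) (≤-trans (n≤1+n (F j)) (Successor.next-grows (step j (stage j))))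

    R-≤ : ∀ {i j} → i ≤′ j → R j ≤Q R i
    R-≤ ≤′-refl         = ≤Q-refl
    R-≤ (≤′-step {j} i≤′j) = ≤Q-trans (Successor.next-≤ (step j (stage j))) (R-≤ i≤′j)

    R-agree : ∀ {i j} → i ≤′ j → Agree (F i) (R i) (R j)
    R-agree ≤′-refl         ℓ _   X = refl
    R-agree (≤′-step {j} i≤′j) ℓ ℓ<F X =
      trans (R-agree i≤′j ℓ ℓ<F X) (Successor.next-agrees (step j (stage j)) ℓ (<-≤-trans ℓ<F (F-mono i≤′j)) X)

    -- The fusion: level ℓ is taken from stage ℓ+1, after which it never changes.
    q : Seq c
    q ℓ = R (suc ℓ) ℓ

    q≤R : ∀ j → q ≤Q R j
    q≤R j ℓ X X∈ with j ≤? suc ℓ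
    ... | yes j≤1+ℓ = R-≤ (≤⇒≤′ j≤1+ℓ) ℓ X X∈
    ... | no  j≰1+ℓ = trans (sym (R-agree (≤⇒≤′ (<⇒≤ (≰⇒> j≰1+ℓ))) ℓ (F-grows (suc ℓ)) X)) X∈

    -- Stage j+1 has a level k ≥ j of norm > j which q inherits; so q is a condition.
    q-cond : Cond q
    q-cond = (λ ℓ → proj₁ (Stage.r-cond (stage (suc ℓ))) ℓ) ,
             (λ ℓ X X∈ → proj₁ (proj₂ cp) ℓ X (q≤R 0 ℓ X X∈)) , q-norms
      where
      q-norms : (r N : ℕ) → Σ ℕ (λ n → (N ≤ n) × NormdAbove (d n) (q n) r)
      q-norms r N = wide , ≤-trans (m≤n+m N r) j≤wide ,
                    NormdAbove-mono {D = d wide} (≤-trans (s≤s z≤n) (d≥2 wide)) (m≤m+n r N)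
                      (NormdAbove-ext {D = d wide} (R-agree (≤⇒≤′ (s≤s j≤wide)) wide wide-below) wide-norm)
        where
        j = r + N
        open Successor (step j (stage j))
        j≤wide : j ≤ wide
        j≤wide = ≤-trans (F-grows j) wide-from

    q-reads : (n : ℕ) (η : Poss q n) → Decides τ (wedge q n η) n
    q-reads n = reads-stronger n (Stage.r-cond (stage n)) q-cond (q≤R n) (Stage.reads (stage n) n (F-grows n))

lemma3p12 : (c h d a : ℕ → ℕ) →
    ((n : ℕ) → h n < c n) →
    Σ ℕ (λ N → (i : ℕ) → N ≤ i → 1 ≤ h i) →
    ((n : ℕ) → 2 ≤ d n) →
    ((r N : ℕ) → Σ ℕ (λ n → (N ≤ n) × (d n ^ (d n * r) < h n))) →
    ((m : ℕ) → Σ ℕ (λ N → (n : ℕ) → N ≤ n → m ≤ d n)) →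
    ((n : ℕ) → 1 ≤ a n) →
    ((n : ℕ) → prodUpTo a n ≤ d n) →
    (τ : Name c h d a) →
    (p : Seq c) → IsCond c h d p →
    Σ (Seq c) (λ q → IsCond c h d q × (q ≤Q p) ×
      ((n : ℕ) (η : Poss q n) → Decides τ (wedge q n η) n))
-- Only c > h, d ≥ 2 and |∏_{i<n} A_i| ≤ d(n) (with A_n ≠ ∅) enter the argument.
-- The fusion q is a condition, lies below stage 0 = p, and reads τ early.
lemma3p12 c h d a h<c _ d≥2 _ _ a≥1 ∏A≤d τ p cp = q , q-cond , q≤R 0 , q-reads
  where
  open EarlyReading.Fusion c h d a h<c d≥2 a≥1 ∏A≤d τ p cp
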